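{- Let $m\ge 2$ and $n\ge2$ be integers and let $\mathbb{A}_0$ be the tensor of order $m$ and dimension $n$ defined in the context. (i) If $k$ is an integer with $1\le k\le n^2-3n+2$ and $k=(n-1)q+r$ with $q\ge0$ and $1\le r\le n-1$, then $S_k(\mathbb{A}_0,n-1)=\{|r-q-1|_n,|r-q|_n,\ldots,|r-1|_n,|r|_n\}$ and $|S_k(\mathbb{A}_0,n-1)|=q+2$. (ii) For every positive integer $t$ and every $j\in\{1,\ldots,n-2\}$, $S_{t+(n-1-j)}(\mathbb{A}_0,j)=S_t(\mathbb{A}_0,n-1)$; moreover $S_{t+n-1}(\mathbb{A}_0,n)=S_t(\mathbb{A}_0,n-1)$.
   Context: A tensor of order $m$ and dimension $n$ is an array $(a_{i_1\cdots i_m})$ with indices in $[n]=\{1,\ldots,n\}$. General product: if $\mathbb{A}$ has order $m\ge2$ and $\mathbb{B}$ has order $p\ge1$, then $\mathbb{A}\mathbb{B}$ is the tensor of order $(m-1)(p-1)+1$ with entries $d_{i\alpha_1\cdots\alpha_{m-1}}=\sum_{i_2,\ldots,i_m=1}^n a_{ii_2\cdots i_m}b_{i_2\alpha_1}\cdots b_{i_m\alpha_{m-1}}$ ($\alpha_l\in[n]^{p-1}$); it is associative, and $\mathbb{A}^{t+1}=\mathbb{A}\mathbb{A}^t$. The majorization matrix of a tensor $\mathbb{B}$ is $(M(\mathbb{B}))_{ij}=b_{ij\cdots j}$. For a nonnegative tensor $\mathbb{A}$, $j\in[n]$ and $t\ge1$, $S_t(\mathbb{A},j)=\{u\in[n]: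 (M(\mathbb{A}^t))_{uj}>0\}$. $|a|_n$ is the unique element of $\{1,\ldots,n\}$ congruent to $a$ mod $n$. $M_1$ is the $n\times n$ $0$-$1$ matrix with $(M_1)_{1,n-1}=(M_1)_{1,n}=1$, $(M_1)_{i+1,i}=1$ ($1\le i\le n-1$), other entries $0$. $\mathbb{A}_0=(a_{i_1\cdots i_m})$ has $a_{ij\cdots j}=(M_1)_{ij}$ for $i,j\in[n]$ and $a_{ii_2\cdots i_m}=0$ whenever $i_2,\ldots,i_m$ are not all equal. -}

module Defs where

open import Data.Nat using (ℕ; zero; suc; _+_; _*_; _∸_; _^_; _≡ᵇ_; _<ᵇ_)
open import Data.Bool using (Bool; true; false; if_then_else_; _∧_; _∨_)
open import Data.Fin using (Fin; toℕ)
open import Data.Vec using (Vec; []; _∷_; replicate; take; drop; zipWith; tabulate; foldr)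
import Data.List as L
open import Data.Nat.ListAction using (sum)
open import Data.Integer using (ℤ; _-_; +_; _%ℕ_)
open import Data.Fin.Subset using (Subset; inside; outside)

-- A tensor of order p and dimension n with nonnegative (natural number) entries:
-- a function of the index tuple (i₁,…,i_p) ∈ [n]^p.  Fin n is 0-based:
-- the paper's index a ∈ [n] corresponds to the element u : Fin n with toℕ u + 1 = a.
Tensor : ℕ → ℕ → Set
Tensor p n = Vec (Fin n) p → ℕ

sumFin : (n : ℕ) → (Fin n → ℕ) → ℕ
sumFin n f = sum (L.map f (L.allFin n))

sumTuples : (n k : ℕ) → (Vec (Fin n) k → ℕ) → ℕ
sumTuples n zero f = f []
sumTuples n (suc k) f = sumFin n (λ i → sumTuples n k (λ is → f (i ∷ is)))

chunks : ∀ {A : Set} (k p : ℕ) → Vec A (k * p) → Vec (Vec A p) k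
chunks zero p xs = []
chunks (suc k) p xs = take p xs ∷ chunks k p (drop p xs)

prodVec : ∀ {k} → Vec ℕ k → ℕ
prodVec = foldr _ _*_ 1

-- General product: A of order m = m'+2 ≥ 2, B of order p = p'+1 ≥ 1;
-- AB has order (m-1)(p-1)+1 = (m'+1)p'+1, with entries
-- d_{i α₁ … α_{m-1}} = Σ_{i₂..i_m} a_{i i₂ … i_m} b_{i₂ α₁} ⋯ b_{i_m α_{m-1}}.
gprod : ∀ {n m' p'} → Tensor (suc (suc m')) n → Tensor (suc p') n →
        Tensor (suc (suc m' * p')) n
gprod {n} {m'} {p'} A B (i ∷ α) =
  sumTuples n (suc m') (λ is →
    A (i ∷ is) * prodVec (zipWith (λ il αl → B (il ∷ αl)) is (chunks (suc m') p' α)))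

-- (order of A^{t+1}) - 1 for A of order m'+2, i.e. (m'+1)^{t+1}
powOrd : ℕ → ℕ → ℕ
powOrd m' zero = suc m'
powOrd m' (suc t) = suc m' * powOrd m' t

-- powSuc A t = A^{t+1}; A^1 = A, A^{t+1} = A A^t
powSuc : ∀ {n m'} → Tensor (suc (suc m')) n → (t : ℕ) → Tensor (suc (powOrd m' t)) n
powSuc A zero = A
powSuc A (suc t) = gprod A (powSuc A t)

majorization : ∀ {n p} → Tensor (suc p) n → Fin n → Fin n → ℕ
majorization {n} {p} B i j = B (i ∷ replicate p j)

-- S_t(A, j) = { u : (M(A^t))_{uj} > 0 }, for t ≥ 1.
-- (t = 0 is not used by the paper; we return the empty set there as a junk value.)
S : ∀ {n m'} → Tensor (suc (suc m')) n → ℕ → Fin n → Subset n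
S A zero j = tabulate (λ _ → outside)
S A (suc t) j = tabulate (λ u → if 0 <ᵇ majorization (powSuc A t) u j then inside else outside)

-- |a|_n : the unique element of {1,…,n} congruent to a mod n  (n = 0 is junk)
absMod : ℕ → ℤ → ℕ
absMod zero a = 0
absMod (suc n) a = suc ((a - + 1) %ℕ suc n)

-- the matrix M₁ (paper's 1-based indices I = toℕ i + 1, J = toℕ j + 1):
-- (M₁)_{1,n-1} = (M₁)_{1,n} = 1, (M₁)_{I+1,I} = 1, other entries 0
M₁ : (n : ℕ) → Fin n → Fin n → ℕ
M₁ n i j =
  let I = suc (toℕ i) ; J = suc (toℕ j) in
  if ((I ≡ᵇ 1) ∧ ((J ≡ᵇ n ∸ 1) ∨ (J ≡ᵇ n))) ∨ (I ≡ᵇ suc J) then 1 else 0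

allEqual : ∀ {n k} → Fin n → Vec (Fin n) k → Bool
allEqual j [] = true
allEqual j (x ∷ xs) = (toℕ x ≡ᵇ toℕ j) ∧ allEqual j xs

A₀ : (m' n : ℕ) → Tensor (suc (suc m')) n
A₀ m' n (i ∷ j ∷ rest) = if allEqual j rest then M₁ n i j else 0

module Submission where

-- 𝔸₀ is diagonally supported (a_{i i₂⋯i_m} = 0 unless i₂ = ⋯ = i_m), and for
-- such tensors (M(A^t))_{uj} > 0 iff the digraph of M(A) has a walk of length t
-- from u to j.  So S_t(𝔸₀, j) is the set of starts of walks of length t into j
-- in the digraph of M₁; 0-based, with n = m + 2, its arcs are w+1 → w, 0 → m and
-- 0 → m+1: two cycles through 0, of lengths m+1 and m+2.
--  (ii) The arcs into x < m and into m+1 are forced (from x+1, resp. from 0);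
--       peeling off these forced last steps gives both identities.
--  (i)  A walk of length k from x into m exists iff x + c(m+1) + b = k + m for
--       some b ≤ c (c laps, b of them long).  For k = (m+1)q + r with q < m only
--       c ∈ {q, q+1} fit, which gives the window x + s + 1 ≡ r (mod n), s ≤ q+1:
--       two disjoint intervals with q + 2 elements in total.

open import Defs
open import Data.Bool using (Bool; true; false; T; if_then_else_; _∧_; _∨_; not)
open import Data.Bool.Properties using (T-∧; T-∨; T-≡)
open import Data.Empty using (⊥; ⊥-elim)
open import Data.Fin as Fin using (Fin; toℕ; fromℕ<; fromℕ; inject₁)
open import Data.Fin.Properties using (toℕ-injective; toℕ-fromℕ<; toℕ-fromℕ; toℕ-inject₁; toℕ<n)
open import Data.Fin.Subset using (Subset; inside; outside; _∈_; ∣_∣)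
open import Data.Fin.Subset.Properties using (⊆-antisym)
open import Data.Integer using (+_; _-_; -_; _⊖_; -[1+_]; _%ℕ_)
import Data.Integer as ℤ using (_+_)
open import Data.Integer.DivMod using (n%ℕd<d)
import Data.Integer.Properties as ℤP
import Data.List as List
open import Data.List.Membership.Propositional using () renaming (_∈_ to _∈ₗ_)
open import Data.List.Membership.Propositional.Properties using (∈-allFin)
open import Data.List.Relation.Unary.Any using (here; there)
open import Data.Nat using (ℕ; zero; suc; _+_; _*_; _∸_; _≤_; _<_; _⊓_; _<ᵇ_; _≡ᵇ_;
  z≤n; z<s; s≤s; s≤s⁻¹; compare; less; equal; greater)
open import Data.Nat.DivMod using (m<n⇒m%n≡m)
open import Data.Nat.ListAction using (sum)
open import Data.Nat.Properties
open import Data.Nat.Tactic.RingSolver using (solve-∀)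
open import Data.Product using (_×_; _,_; ∃; proj₁; proj₂)
open import Data.Product.Function.NonDependent.Propositional using (_×-⇔_)
open import Data.Sum using (_⊎_; inj₁; inj₂)
open import Data.Sum.Function.Propositional using (_⊎-⇔_)
open import Data.Vec using (Vec; []; _∷_; replicate; take; drop; zipWith; tabulate)
open import Data.Vec.Properties using (lookup∘tabulate; []=⇒lookup; lookup⇒[]=)
open import Function.Base using (_∘_)
open import Function.Bundles using (_⇔_; mk⇔; Equivalence)
open import Function.Construct.Composition using (_⇔-∘_)
open import Function.Construct.Identity using (⇔-id)
open import Function.Construct.Symmetry using (⇔-sym)
open import Relation.Binary.PropositionalEquality
open import Relation.Nullary using (yes; no)

+-pos⇒ : ∀ a b → 0 < a + b → 0 < a ⊎ 0 < b
+-pos⇒ zero    b b>0 = inj₂ b>0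
+-pos⇒ (suc a) b _   = inj₁ z<s

*-pos⇒ : ∀ a b → 0 < a * b → 0 < a × 0 < b
*-pos⇒ zero    b       ()
*-pos⇒ (suc a) zero    ab>0 rewrite *-zeroʳ a = z<s , ab>0
*-pos⇒ (suc a) (suc b) _    = z<s , z<s

*-pos : ∀ {a b} → 0 < a → 0 < b → 0 < a * b
*-pos {suc a} {suc b} _ _ = z<s

sum-pos⇒ : ∀ {X : Set} (f : X → ℕ) xs → 0 < sum (List.map f xs) → ∃ λ x → 0 < f x
sum-pos⇒ f List.[]       ()
sum-pos⇒ f (x List.∷ xs) pos with +-pos⇒ (f x) _ pos
... | inj₁ fx>0 = x , fx>0
... | inj₂ rest = sum-pos⇒ f xs rest

sum-pos : ∀ {X : Set} (f : X → ℕ) {xs x} → x ∈ₗ xs → 0 < f x → 0 < sum (List.map f xs)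
sum-pos f {y List.∷ _} (here refl) fx>0 = <-≤-trans fx>0 (m≤m+n (f y) _)
sum-pos f {y List.∷ _} (there x∈) fx>0 = <-≤-trans (sum-pos f x∈ fx>0) (m≤n+m _ (f y))

sumTuples-pos⇒ : ∀ n k (f : Vec (Fin n) k → ℕ) → 0 < sumTuples n k f → ∃ λ is → 0 < f is
sumTuples-pos⇒ n zero    f pos = [] , pos
sumTuples-pos⇒ n (suc k) f pos with sum-pos⇒ _ (List.allFin n) pos
... | i , inner with sumTuples-pos⇒ n k (λ is → f (i ∷ is)) inner
... | is , fis>0 = i ∷ is , fis>0

sumTuples-pos : ∀ n k (f : Vec (Fin n) k → ℕ) is → 0 < f is → 0 < sumTuples n k f
sumTuples-pos n zero    f []       fis>0 = fis>0
sumTuples-pos n (suc k) f (i ∷ is) fis>0 =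
  sum-pos _ (∈-allFin i) (sumTuples-pos n k (λ js → f (i ∷ js)) is fis>0)

prodVec-replicate-pos : ∀ {X Y : Set} k (g : X → Y → ℕ) x y → 0 < g x y →
  0 < prodVec (zipWith g (replicate k x) (replicate k y))
prodVec-replicate-pos zero    g x y _     = z<s
prodVec-replicate-pos (suc k) g x y gxy>0 = *-pos gxy>0 (prodVec-replicate-pos k g x y gxy>0)

take-replicate : ∀ {X : Set} p q (x : X) → take p (replicate (p + q) x) ≡ replicate p x
take-replicate zero    q x = refl
take-replicate (suc p) q x = cong (x ∷_) (take-replicate p q x)

drop-replicate : ∀ {X : Set} p q (x : X) → drop p (replicate (p + q) x) ≡ replicate q x
drop-replicate zero    q x = refl
drop-replicate (suc p) q x = drop-replicate p q x

chunks-replicate : ∀ {X : Set} k p (x : X) →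
  chunks k p (replicate (k * p) x) ≡ replicate k (replicate p x)
chunks-replicate zero    p x = refl
chunks-replicate (suc k) p x = cong₂ _∷_ (take-replicate p (k * p) x)
  (trans (cong (chunks k p) (drop-replicate p (k * p) x)) (chunks-replicate k p x))

Walk : {V : Set} → (V → V → Set) → ℕ → V → V → Set
Walk E zero    u v = u ≡ v
Walk E (suc k) u v = ∃ λ w → E u w × Walk E k w v

walk-map : ∀ {V : Set} {E E′ : V → V → Set} → (∀ {u w} → E u w → E′ u w) →
  ∀ k {u v} → Walk E k u v → Walk E′ k u v
walk-map f zero    u≡v              = u≡v
walk-map f (suc k) (w , arc , walk) = w , f arc , walk-map f k walk

walk-snoc : ∀ {V : Set} {E : V → V → Set} k {u w v} → Walk E k u w → E w v → Walk E (suc k) u v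
walk-snoc zero    refl               arc′ = _ , arc′ , refl
walk-snoc (suc k) (w , arc , walk) arc′ = w , arc , walk-snoc k walk arc′

walk-unsnoc : ∀ {V : Set} {E : V → V → Set} k {u v} → Walk E (suc k) u v →
  ∃ λ w → Walk E k u w × E w v
walk-unsnoc zero    (w , arc , refl) = _ , refl , arc
walk-unsnoc (suc k) (w , arc , walk) with walk-unsnoc k walk
... | w′ , walk′ , arc′ = w′ , (w , arc , walk′) , arc′

PosArc : ∀ {n p} → Tensor (suc p) n → Fin n → Fin n → Set
PosArc A u v = 0 < majorization A u v

DiagonallySupported : ∀ {n m′} → Tensor (suc (suc m′)) n → Set
DiagonallySupported {n} {m′} A = ∀ u v rest → 0 < A (u ∷ v ∷ rest) → rest ≡ replicate m′ v

-- This is the combinatorial core of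
-- Proposition 2.14: M(A^t) has the zero pattern of M(A)^t.
module _ {n m′ : ℕ} (A : Tensor (suc (suc m′)) n) where

  entry : ∀ t → Fin n → Vec (Fin n) (powOrd m′ t) → ℕ
  entry t i α = powSuc A t (i ∷ α)

  -- the factor b_{i₂ α₁} ⋯ b_{i_m α_{m-1}} of an entry (u, j⋯j) of A·A^{t+1}
  blockProduct : ∀ t → Vec (Fin n) (suc m′) → Fin n → ℕ
  blockProduct t is j =
    prodVec (zipWith (entry t) is (chunks (suc m′) (powOrd m′ t) (replicate (suc m′ * powOrd m′ t) j)))

  -- (M(A^{t+2}))_{uj} is the sum of these summands over (i₂,…,i_m)
  summand : ∀ t → Fin n → Fin n → Vec (Fin n) (suc m′) → ℕ
  summand t u j is = A (u ∷ is) * blockProduct t is j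

  blockProduct-constant : ∀ t (is : Vec (Fin n) (suc m′)) j →
    blockProduct t is j ≡ prodVec (zipWith (entry t) is (replicate (suc m′) (replicate (powOrd m′ t) j)))
  blockProduct-constant t is j = cong (λ αs → prodVec (zipWith (entry t) is αs))
                                      (chunks-replicate (suc m′) (powOrd m′ t) j)

  walk⇒majorization-pos : ∀ t {u j} → Walk (PosArc A) (suc t) u j →
    0 < majorization (powSuc A t) u j
  walk⇒majorization-pos zero    (w , arc , refl)     = arc
  walk⇒majorization-pos (suc t) {u} {j} (w , arc , walk) =
    sumTuples-pos n (suc m′) (summand t u j) (replicate (suc m′) w) (*-pos arc product>0)
    where
    product>0 : 0 < blockProduct t (replicate (suc m′) w) j
    product>0 = subst (0 <_) (sym (blockProduct-constant t (replicate (suc m′) w) j))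
      (prodVec-replicate-pos (suc m′) (entry t) w _ (walk⇒majorization-pos t walk))

  majorization-pos⇒walk : DiagonallySupported A → ∀ t {u j} →
    0 < majorization (powSuc A t) u j → Walk (PosArc A) (suc t) u j
  majorization-pos⇒walk support zero    {u} {j} pos = j , pos , refl
  majorization-pos⇒walk support (suc t) {u} {j} pos
    with sumTuples-pos⇒ n (suc m′) (summand t u j) pos
  ... | v ∷ rest , summand>0 with *-pos⇒ (A (u ∷ v ∷ rest)) _ summand>0
  ... | a>0 , product>0 = v , arc , majorization-pos⇒walk support t first-factor>0
    where
    arc : PosArc A u v
    arc = subst (λ is → 0 < A (u ∷ v ∷ is)) (support u v rest a>0) a>0
    first-factor>0 : 0 < majorization (powSuc A t) v j
    first-factor>0 = proj₁ (*-pos⇒ _ _ (subst (0 <_) (blockProduct-constant t (v ∷ rest) j) product>0))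

subset-ext : ∀ {n} {p q : Subset n} → (∀ u → u ∈ p ⇔ u ∈ q) → p ≡ q
subset-ext p⇔q = ⊆-antisym (λ {u} → Equivalence.to (p⇔q u)) (λ {u} → Equivalence.from (p⇔q u))

inside-if⇔ : ∀ c → (if c then inside else outside) ≡ inside ⇔ T c
inside-if⇔ true  = mk⇔ (λ _ → _) (λ _ → refl)
inside-if⇔ false = mk⇔ (λ ()) (λ ())

∈-decided⇔ : ∀ {n} (b : Fin n → Bool) u →
  u ∈ tabulate (λ v → if b v then inside else outside) ⇔ T (b u)
∈-decided⇔ {n} b u = inside-if⇔ (b u) ⇔-∘
  mk⇔ (λ u∈ → trans (sym (lookup∘tabulate f u)) ([]=⇒lookup u∈))
      (λ fu≡inside → lookup⇒[]= u (tabulate f) (trans (lookup∘tabulate f u) fu≡inside))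
  where
  f : Fin n → Bool
  f v = if b v then inside else outside

∈S⇔majorization-pos : ∀ {n m′} (A : Tensor (suc (suc m′)) n) t u j →
  u ∈ S A (suc t) j ⇔ 0 < majorization (powSuc A t) u j
∈S⇔majorization-pos A t u j = mk⇔ (<ᵇ⇒< 0 _ ∘ Equivalence.to membership)
                                   (Equivalence.from membership ∘ <⇒<ᵇ)
  where
  membership : u ∈ S A (suc t) j ⇔ T (0 <ᵇ majorization (powSuc A t) u j)
  membership = ∈-decided⇔ (λ v → 0 <ᵇ majorization (powSuc A t) v j) u

count : ℕ → (ℕ → Bool) → ℕ
count zero    h = 0
count (suc N) h = (if h 0 then 1 else 0) + count N (h ∘ suc)

∣tabulate∣≡count : ∀ N (h : ℕ → Bool) →
  ∣ tabulate {n = N} (λ u → if h (toℕ u) then inside else outside) ∣ ≡ count N h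
∣tabulate∣≡count zero    h = refl
∣tabulate∣≡count (suc N) h with h 0
... | true  = cong suc (∣tabulate∣≡count N (h ∘ suc))
... | false = ∣tabulate∣≡count N (h ∘ suc)

count-∨ : ∀ N (f g : ℕ → Bool) → (∀ x → T (f x) → T (g x) → ⊥) →
  count N (λ x → f x ∨ g x) ≡ count N f + count N g
count-∨ zero    f g disjoint = refl
count-∨ (suc N) f g disjoint with f 0 in f0 | g 0 in g0
... | true  | true  = ⊥-elim (disjoint 0 (subst T (sym f0) _) (subst T (sym g0) _))
... | true  | false = cong suc (count-∨ N (f ∘ suc) (g ∘ suc) (disjoint ∘ suc))
... | false | true  = trans (cong suc (count-∨ N (f ∘ suc) (g ∘ suc) (disjoint ∘ suc))) (sym (+-suc _ _))
... | false | false = count-∨ N (f ∘ suc) (g ∘ suc) (disjoint ∘ suc)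

count-none : ∀ N → count N (λ _ → false) ≡ 0
count-none zero    = refl
count-none (suc N) = count-none N

inInterval : ℕ → ℕ → ℕ → Bool
inInterval a b x = (x <ᵇ b) ∧ not (x <ᵇ a)

T-not⇔¬T : ∀ {c} → T (not c) ⇔ (T c → ⊥)
T-not⇔¬T {true}  = mk⇔ (λ ()) (λ ¬t → ¬t _)
T-not⇔¬T {false} = mk⇔ (λ _ ()) (λ _ → _)

T-inInterval : ∀ a b x → T (inInterval a b x) ⇔ (a ≤ x × x < b)
T-inInterval a b x = mk⇔ to from
  where
  to : T (inInterval a b x) → a ≤ x × x < b
  to t with Equivalence.to T-∧ t
  ... | x<b , x≮a = ≮⇒≥ (Equivalence.to T-not⇔¬T x≮a ∘ <⇒<ᵇ) , <ᵇ⇒< x b x<b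
  from : a ≤ x × x < b → T (inInterval a b x)
  from (a≤x , x<b) = Equivalence.from T-∧
    (<⇒<ᵇ x<b , Equivalence.from T-not⇔¬T (λ x<a → <⇒≱ (<ᵇ⇒< x a x<a) a≤x))

count-interval : ∀ N a b → b ≤ N → count N (inInterval a b) ≡ b ∸ a
count-interval N       a       zero    _         = trans (count-none N) (sym (0∸n≡0 a))
count-interval (suc N) zero    (suc b) (s≤s b≤N) = cong suc (count-interval N 0 b b≤N)
count-interval (suc N) (suc a) (suc b) (s≤s b≤N) = count-interval N a b b≤N

bounded-gap : ∀ d x R → (∃ λ s → s ≤ d × x + suc s ≡ R) ⇔ (R ∸ suc d ≤ x × x < R)
bounded-gap d x R = mk⇔ to from
  where
  to : (∃ λ s → s ≤ d × x + suc s ≡ R) → R ∸ suc d ≤ x × x < R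
  to (s , s≤d , x+s+1≡R) =
    m≤n+o⇒m∸n≤o R (suc d) (≤-trans (≤-reflexive (sym x+s+1≡R))
                                    (≤-trans (+-monoʳ-≤ x (s≤s s≤d)) (≤-reflexive (+-comm x (suc d))))) ,
    <-≤-trans (m<m+n x z<s) (≤-reflexive x+s+1≡R)
  from : R ∸ suc d ≤ x × x < R → ∃ λ s → s ≤ d × x + suc s ≡ R
  from (lo , x<R) = R ∸ suc x ,
    m≤n+o⇒m∸n≤o R (suc x) (≤-trans (m≤n+m∸n R (suc d))
                                    (≤-trans (+-monoʳ-≤ (suc d) lo) (≤-reflexive (cong suc (+-comm d x))))) ,
    trans (+-suc x (R ∸ suc x)) (m+[n∸m]≡n x<R)

r∸[r∸d]≡r⊓d : ∀ r d → r ∸ (r ∸ d) ≡ r ⊓ d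
r∸[r∸d]≡r⊓d r d with ≤-total d r
... | inj₁ d≤r = trans (m∸[m∸n]≡n d≤r) (sym (m≥n⇒m⊓n≡n d≤r))
... | inj₂ r≤d = trans (cong (r ∸_) (m≤n⇒m∸n≡0 r≤d)) (sym (m≤n⇒m⊓n≡m r≤d))

-- The two pieces [r-d, r) and [r+N-d, N) of a cyclic interval of length d ≤ N
-- ending just below r have d elements in total.
cyclic-interval-size : ∀ r d N → d ≤ N → (r ∸ (r ∸ d)) + (N ∸ (r + N ∸ d)) ≡ d
cyclic-interval-size r d N d≤N = begin
  (r ∸ (r ∸ d)) + (N ∸ (r + N ∸ d))    ≡⟨ cong₂ _+_ (r∸[r∸d]≡r⊓d r d)
                                                  (cong (N ∸_) (+-∸-assoc r d≤N)) ⟩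
  r ⊓ d + (N ∸ (r + (N ∸ d)))          ≡⟨ cong (λ y → r ⊓ d + (N ∸ y)) (+-comm r (N ∸ d)) ⟩
  r ⊓ d + (N ∸ ((N ∸ d) + r))          ≡⟨ cong (_+_ (r ⊓ d)) (∸-+-assoc N (N ∸ d) r) ⟨
  r ⊓ d + (N ∸ (N ∸ d) ∸ r)            ≡⟨ cong (λ y → r ⊓ d + (y ∸ r)) (m∸[m∸n]≡n d≤N) ⟩
  r ⊓ d + (d ∸ r)                      ≡⟨ m⊓n+n∸m≡n r d ⟩
  d                                    ∎
  where open ≡-Reasoning

-- The digraph of M₁ for n = m + 2, in 0-based indices: arcs 0 → m and
-- 0 → m+1 (the entries (M₁)_{1,n-1}, (M₁)_{1,n}) and w+1 → w (the subdiagonal).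
Arc : (m : ℕ) → Fin (suc (suc m)) → Fin (suc (suc m)) → Set
Arc m u w = (toℕ u ≡ 0 × (toℕ w ≡ m ⊎ toℕ w ≡ suc m)) ⊎ toℕ u ≡ suc (toℕ w)

T-≡ᵇ : ∀ {a b} → T (a ≡ᵇ b) ⇔ a ≡ b
T-≡ᵇ {a} {b} = mk⇔ (≡ᵇ⇒≡ a b) (≡⇒≡ᵇ a b)

if-pos⇒ : ∀ b {x} → 0 < (if b then x else 0) → T b
if-pos⇒ true _ = _

if-pos⇔ : ∀ b → 0 < (if b then 1 else 0) ⇔ T b
if-pos⇔ b = mk⇔ (if-pos⇒ b) (if-true b)
  where
  if-true : ∀ b → T b → 0 < (if b then 1 else 0)
  if-true true _ = z<s

M₁-pos⇔Arc : ∀ m u w → 0 < M₁ (suc (suc m)) u w ⇔ Arc m u w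
M₁-pos⇔Arc m u w =
  (((T-≡ᵇ ×-⇔ ((T-≡ᵇ ⊎-⇔ T-≡ᵇ) ⇔-∘ T-∨)) ⇔-∘ T-∧) ⊎-⇔ T-≡ᵇ) ⇔-∘ (T-∨ ⇔-∘ if-pos⇔ _)

allEqual⇒replicate : ∀ {n k} (j : Fin n) (rest : Vec (Fin n) k) → T (allEqual j rest) → rest ≡ replicate k j
allEqual⇒replicate j []       _     = refl
allEqual⇒replicate j (x ∷ xs) all-equal with Equivalence.to T-∧ all-equal
... | x≡j , xs-equal = cong₂ _∷_ (toℕ-injective (≡ᵇ⇒≡ (toℕ x) (toℕ j) x≡j))
                                 (allEqual⇒replicate j xs xs-equal)

allEqual-replicate : ∀ {n} (j : Fin n) k → T (allEqual j (replicate k j))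
allEqual-replicate j zero    = _
allEqual-replicate j (suc k) = Equivalence.from T-∧ (≡⇒≡ᵇ (toℕ j) (toℕ j) refl , allEqual-replicate j k)

A₀-diagonallySupported : ∀ m′ n → DiagonallySupported (A₀ m′ n)
A₀-diagonallySupported m′ n u v rest pos = allEqual⇒replicate v rest (if-pos⇒ (allEqual v rest) pos)

majorization-A₀ : ∀ m′ n u v → majorization (A₀ m′ n) u v ≡ M₁ n u v
majorization-A₀ m′ n u v =
  cong (λ b → if b then M₁ n u v else 0) (Equivalence.to T-≡ (allEqual-replicate v m′))

A₀-arc⇔Arc : ∀ m′ m u v → PosArc (A₀ m′ (suc (suc m))) u v ⇔ Arc m u v
A₀-arc⇔Arc m′ m u v = M₁-pos⇔Arc m u v ⇔-∘ mk⇔ (subst (0 <_) M≡M₁) (subst (0 <_) (sym M≡M₁))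
  where
  M≡M₁ : majorization (A₀ m′ (suc (suc m))) u v ≡ M₁ (suc (suc m)) u v
  M≡M₁ = majorization-A₀ m′ (suc (suc m)) u v

∈S-A₀⇔walk : ∀ m′ m t u j → u ∈ S (A₀ m′ (suc (suc m))) (suc t) j ⇔ Walk (Arc m) (suc t) u j
∈S-A₀⇔walk m′ m t u j = mk⇔
  (walk-map (Equivalence.to (A₀-arc⇔Arc m′ m _ _)) (suc t)
    ∘ majorization-pos⇒walk A (A₀-diagonallySupported m′ _) t
    ∘ Equivalence.to (∈S⇔majorization-pos A t u j))
  (Equivalence.from (∈S⇔majorization-pos A t u j)
    ∘ walk⇒majorization-pos A t
    ∘ walk-map (Equivalence.from (A₀-arc⇔Arc m′ m _ _)) (suc t))
  where
  A : Tensor (suc (suc m′)) (suc (suc m))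
  A = A₀ m′ (suc (suc m))

S-A₀-ext : ∀ m′ m t t′ j j′ → (∀ u → Walk (Arc m) (suc t) u j ⇔ Walk (Arc m) (suc t′) u j′) →
  S (A₀ m′ (suc (suc m))) (suc t) j ≡ S (A₀ m′ (suc (suc m))) (suc t′) j′
S-A₀-ext m′ m t t′ j j′ walks = subset-ext λ u →
  ⇔-sym (∈S-A₀⇔walk m′ m t′ u j′) ⇔-∘ (walks u ⇔-∘ ∈S-A₀⇔walk m′ m t u j)

-- Walks in the digraph of M₁, with n = m + 2 vertices 0, …, m+1.
module _ (m : ℕ) where

  -- Below the vertex m the only arc into x comes from x+1, so a walk into x
  -- of length k+1 is a walk of length k into x+1.
  walk-into-low : ∀ k {u x y} → toℕ x < m → toℕ y ≡ suc (toℕ x) →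
    Walk (Arc m) (suc k) u x ⇔ Walk (Arc m) k u y
  walk-into-low k {x = x} {y} x<m y≡x+1 = mk⇔ to (λ walk → walk-snoc k walk (inj₂ y≡x+1))
    where
    to : ∀ {u} → Walk (Arc m) (suc k) u x → Walk (Arc m) k u y
    to walk with walk-unsnoc k walk
    ... | w , walk′ , inj₁ (_ , inj₁ x≡m)   = ⊥-elim (<-irrefl x≡m x<m)
    ... | w , walk′ , inj₁ (_ , inj₂ x≡m+1) = ⊥-elim (<-asym x<m (≤-reflexive (sym x≡m+1)))
    ... | w , walk′ , inj₂ w≡x+1 = subst (Walk (Arc m) k _) (toℕ-injective (trans w≡x+1 (sym y≡x+1))) walk′

  walk-descend : ∀ d k {u x jₘ} → toℕ jₘ ≡ m → toℕ x + d ≡ m →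
    Walk (Arc m) (d + k) u x ⇔ Walk (Arc m) k u jₘ
  walk-descend zero k {u} {x} jₘ≡m x≡m =
    subst (λ v → Walk (Arc m) k u x ⇔ Walk (Arc m) k u v)
          (toℕ-injective (trans (trans (sym (+-identityʳ (toℕ x))) x≡m) (sym jₘ≡m))) (⇔-id _)
  walk-descend (suc d) k {x = x} jₘ≡m x+d+1≡m =
    walk-descend d k jₘ≡m y+d≡m ⇔-∘ walk-into-low (d + k) x<m (toℕ-fromℕ< y<n)
    where
    x<m : toℕ x < m
    x<m = <-≤-trans (m<m+n (toℕ x) z<s) (≤-reflexive x+d+1≡m)
    y<n : suc (toℕ x) < suc (suc m)
    y<n = s≤s (<⇒≤ (s≤s x<m))
    y+d≡m : toℕ (fromℕ< y<n) + d ≡ m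
    y+d≡m = trans (cong (_+ d) (toℕ-fromℕ< y<n)) (trans (sym (+-suc (toℕ x) d)) x+d+1≡m)

  -- The only arc into the vertex m+1 comes from 0.
  walk-into-top : ∀ k {u jₙ} → toℕ jₙ ≡ suc m →
    Walk (Arc m) (suc k) u jₙ ⇔ Walk (Arc m) k u Fin.zero
  walk-into-top k {jₙ = jₙ} jₙ≡m+1 = mk⇔ to (λ walk → walk-snoc k walk (inj₁ (refl , inj₂ jₙ≡m+1)))
    where
    to : ∀ {u} → Walk (Arc m) (suc k) u jₙ → Walk (Arc m) k u Fin.zero
    to walk with walk-unsnoc k walk
    ... | w , walk′ , inj₁ (w≡0 , _) = subst (Walk (Arc m) k _) (toℕ-injective w≡0) walk′
    ... | w , walk′ , inj₂ w≡m+2 =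
      ⊥-elim (<-irrefl (trans w≡m+2 (cong suc jₙ≡m+1)) (toℕ<n w))

  -- A walk into the vertex m first descends from x to 0 and then runs c times
  -- around the two cycles through 0, of lengths m+1 (via 0 → m) and m+2 (via
  -- 0 → m+1), b of them the long one, the last lap stopping m steps early.
  -- So a walk of length k from x into m exists iff x + c(m+1) + b = k + m, b ≤ c.
  CycleCount : ℕ → ℕ → Set
  CycleCount k x = ∃ λ c → ∃ λ b → b ≤ c × x + c * suc m + b ≡ k + m

  walk⇒cycleCount : ∀ k {u jₘ} → toℕ jₘ ≡ m → Walk (Arc m) k u jₘ → CycleCount k (toℕ u)
  walk⇒cycleCount zero    jₘ≡m refl = 0 , 0 , z≤n , trans (+-identityʳ _) (trans (+-identityʳ _) jₘ≡m)
  walk⇒cycleCount (suc k) jₘ≡m (w , arc , walk) with walk⇒cycleCount k jₘ≡m walk | arc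
  ... | c , b , b≤c , eq | inj₂ u≡w+1 rewrite u≡w+1 = c , b , b≤c , cong suc eq
  ... | c , b , b≤c , eq | inj₁ (u≡0 , inj₁ w≡m) rewrite u≡0 | w≡m =
    suc c , b , m≤n⇒m≤1+n b≤c , cong suc eq
  ... | c , b , b≤c , eq | inj₁ (u≡0 , inj₂ w≡m+1) rewrite u≡0 | w≡m+1 =
    suc c , suc b , s≤s b≤c , cong suc (trans (+-suc (m + c * suc m) b) eq)

  cycleCount⇒walk : ∀ k {u jₘ} → toℕ jₘ ≡ m → CycleCount k (toℕ u) → Walk (Arc m) k u jₘ
  cycleCount⇒walk zero {u} jₘ≡m (zero , zero , _ , eq) =
    toℕ-injective (trans (sym (trans (+-identityʳ _) (+-identityʳ _))) (trans eq (sym jₘ≡m)))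
  cycleCount⇒walk zero {u} jₘ≡m (suc c , b , _ , eq) = ⊥-elim (<-irrefl (sym eq) m<lhs)
    where
    m<lhs : m < toℕ u + (suc m + c * suc m) + b
    m<lhs = <-≤-trans (n<1+n m) (≤-trans (m≤m+n (suc m) _) (≤-trans (m≤n+m _ (toℕ u)) (m≤m+n _ b)))
  cycleCount⇒walk (suc k) {Fin.suc u} jₘ≡m (c , b , b≤c , eq) =
    inject₁ u , inj₂ (cong suc (sym (toℕ-inject₁ u))) ,
    cycleCount⇒walk k jₘ≡m (c , b , b≤c , trans (cong (λ x → x + c * suc m + b) (toℕ-inject₁ u))
                                                (suc-injective eq))
  cycleCount⇒walk (suc k) {Fin.zero} jₘ≡m (zero , zero , _ , ())
  cycleCount⇒walk (suc k) {Fin.zero} {jₘ} jₘ≡m (suc c , zero , _ , eq) =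
    jₘ , inj₁ (refl , inj₁ jₘ≡m) ,
    cycleCount⇒walk k jₘ≡m (c , 0 , z≤n , trans (cong (λ x → x + c * suc m + 0) jₘ≡m) (suc-injective eq))
  cycleCount⇒walk (suc k) {Fin.zero} jₘ≡m (suc c , suc b , s≤s b≤c , eq) =
    fromℕ (suc m) , inj₁ (refl , inj₂ (toℕ-fromℕ (suc m))) ,
    cycleCount⇒walk k jₘ≡m (c , b , b≤c , trans (cong (λ x → x + c * suc m + b) (toℕ-fromℕ (suc m)))
                                              (trans (sym (+-suc (m + c * suc m) b)) (suc-injective eq)))

  -- x + t ≡ r (mod n) with n = m + 2, in the range x + t < r + 2n that occurs here.
  Hits : ℕ → ℕ → ℕ → Set
  Hits r x t = x + t ≡ r ⊎ x + t ≡ r + suc (suc m)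

  -- The window {|r-q-1|_n, …, |r|_n} of the paper in 0-based form.
  Window : ℕ → ℕ → ℕ → Set
  Window q r x = ∃ λ s → s ≤ q + 1 × Hits r x (suc s)

  private
    +-suc² : ∀ a b → a + suc (suc b) ≡ suc (suc (a + b))
    +-suc² a b = trans (+-suc a (suc b)) (cong suc (+-suc a b))

  -- With k = (m+1)q + r and q < m, fewer than q laps are too short ...
  too-few-laps : ∀ {x b c k r} → x ≤ suc m → b ≤ c → c < m →
    x + c * suc m + b < suc m * suc (c + k) + r + m
  too-few-laps {x} {b} {c} {k} {r} x≤m+1 b≤c c<m = begin-strict
    x + c * suc m + b      ≤⟨ +-mono-≤ (+-monoˡ-≤ (c * suc m) x≤m+1) b≤c ⟩
    suc c * suc m + c      <⟨ +-monoʳ-< (suc c * suc m) c<m ⟩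
    suc c * suc m + m      ≤⟨ +-monoˡ-≤ m laps ⟩
    suc m * suc (c + k) + r + m ∎
    where
    open ≤-Reasoning
    laps : suc c * suc m ≤ suc m * suc (c + k) + r
    laps = begin
      suc c * suc m         ≤⟨ *-monoˡ-≤ (suc m) (s≤s (m≤m+n c k)) ⟩
      suc (c + k) * suc m   ≡⟨ *-comm (suc (c + k)) (suc m) ⟩
      suc m * suc (c + k)   ≤⟨ m≤m+n _ r ⟩
      suc m * suc (c + k) + r ∎

  -- ... and more than q+1 laps are too long.
  too-many-laps : ∀ {x b q k r} → r ≤ suc m →
    suc m * q + r + m < x + suc (q + suc k) * suc m + b
  too-many-laps {x} {b} {q} {k} {r} r≤m+1 = begin-strict
    suc m * q + r + m                ≤⟨ +-monoˡ-≤ m (+-monoʳ-≤ (suc m * q) r≤m+1) ⟩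
    suc m * q + suc m + m            <⟨ +-monoʳ-< (suc m * q + suc m) (n<1+n m) ⟩
    suc m * q + suc m + suc m        ≡⟨ two-more-laps q m ⟩
    suc (suc q) * suc m              ≤⟨ *-monoˡ-≤ (suc m) (s≤s q+1≤q+k+1) ⟩
    suc (q + suc k) * suc m          ≤⟨ m≤n+m _ x ⟩
    x + suc (q + suc k) * suc m      ≤⟨ m≤m+n _ b ⟩
    x + suc (q + suc k) * suc m + b  ∎
    where
    open ≤-Reasoning
    two-more-laps : ∀ q m → suc m * q + suc m + suc m ≡ suc (suc q) * suc m
    two-more-laps = solve-∀
    q+1≤q+k+1 : suc q ≤ q + suc k
    q+1≤q+k+1 = ≤-trans (s≤s (m≤m+n q k)) (≤-reflexive (sym (+-suc q k)))

  -- So the number of laps is q (and the walk used at least one long lap) or q+1.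
  cycleCount⇒window : ∀ {q r x} → q < m → r ≤ suc m → x ≤ suc m →
    CycleCount (suc m * q + r) x → Window q r x
  cycleCount⇒window {q} {r} {x} q<m r≤m+1 x≤m+1 (c , b , b≤c , eq) with compare c q
  ... | less c k = ⊥-elim (<-irrefl eq (too-few-laps x≤m+1 b≤c (<-trans (s≤s (m≤m+n c k)) q<m)))
  ... | equal q = suc b , subst (suc b ≤_) (+-comm 1 q) (s≤s b≤c) ,
      inj₂ (trans (+-suc² x b) (trans (cong (suc ∘ suc) x+b≡r+m) (sym (+-suc² r m))))
    where
    lhs : ∀ x q b m → x + q * suc m + b ≡ suc m * q + (x + b)
    lhs = solve-∀
    x+b≡r+m : x + b ≡ r + m
    x+b≡r+m = +-cancelˡ-≡ (suc m * q) _ _ (trans (sym (lhs x q b m)) (trans eq (+-assoc (suc m * q) r m)))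
  ... | greater q zero = b , subst (b ≤_) (trans (cong suc (+-identityʳ q)) (+-comm 1 q)) b≤c ,
      inj₁ (+-cancelˡ-≡ (suc m * q) _ _ (+-cancelʳ-≡ m _ _ (trans (sym (lhs x q b m)) eq)))
    where
    lhs : ∀ x q b m → x + suc (q + 0) * suc m + b ≡ suc m * q + (x + suc b) + m
    lhs = solve-∀
  ... | greater q (suc k) = ⊥-elim (<-irrefl (sym eq) (too-many-laps {x} {b} {q} {k} r≤m+1))

  window⇒cycleCount : ∀ {q r x} → 1 ≤ r → x ≤ suc m → Window q r x → CycleCount (suc m * q + r) x
  window⇒cycleCount {q} {r} {x} _ _ (s , s≤q+1 , inj₁ x+s+1≡r) =
    suc q , s , subst (s ≤_) (+-comm q 1) s≤q+1 ,
    trans (lhs x q s m) (cong (λ y → suc m * q + y + m) x+s+1≡r)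
    where
    lhs : ∀ x q s m → x + suc q * suc m + s ≡ suc m * q + (x + suc s) + m
    lhs = solve-∀
  window⇒cycleCount {q} {r} {x} 1≤r x≤m+1 (zero , _ , inj₂ x+1≡r+n) = ⊥-elim (<-irrefl x+1≡r+n x+1<r+n)
    where
    open ≤-Reasoning
    x+1<r+n : x + 1 < r + suc (suc m)
    x+1<r+n = begin-strict
      x + 1         ≡⟨ +-comm x 1 ⟩
      suc x         ≤⟨ s≤s x≤m+1 ⟩
      suc (suc m)   <⟨ m<n+m (suc (suc m)) 1≤r ⟩
      r + suc (suc m) ∎
  window⇒cycleCount {q} {r} {x} _ _ (suc s , s+1≤q+1 , inj₂ x+s+2≡r+n) =
    q , s , s≤s⁻¹ (subst (suc s ≤_) (+-comm q 1) s+1≤q+1) ,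
    trans (lhs x q s m) (trans (cong (_+_ (suc m * q)) x+s≡r+m) (sym (+-assoc (suc m * q) r m)))
    where
    lhs : ∀ x q s m → x + q * suc m + s ≡ suc m * q + (x + s)
    lhs = solve-∀
    x+s≡r+m : x + s ≡ r + m
    x+s≡r+m = suc-injective (suc-injective (trans (sym (+-suc² x s)) (trans x+s+2≡r+n (+-suc² r m))))

  -- The 0-based value of |r - s|_n, i.e. absMod n (r - s) = 1 + residue r s.
  residue : ℕ → ℕ → ℕ
  residue r s = ((+ r - + s) - + 1) %ℕ suc (suc m)

  private
    subtract-one : ∀ r s → (+ r - + s) - + 1 ≡ r ⊖ suc s
    subtract-one r s = begin
      (+ r - + s) - + 1        ≡⟨ ℤP.+-assoc (+ r) (- + s) (- + 1) ⟩
      (+ r) ℤ.+ ((- + s) - + 1) ≡⟨ cong (λ z → (+ r) ℤ.+ z) (sym (ℤP.neg-distrib-+ (+ s) (+ 1))) ⟩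
      + r - + (s + 1)          ≡⟨ ℤP.m-n≡m⊖n r (s + 1) ⟩
      r ⊖ (s + 1)              ≡⟨ cong (r ⊖_) (+-comm s 1) ⟩
      r ⊖ suc s                ∎
      where open ≡-Reasoning

    negative-residue : ∀ y → suc y < suc (suc m) → -[1+ y ] %ℕ suc (suc m) ≡ suc (suc m) ∸ suc y
    negative-residue y y+1<n rewrite m<n⇒m%n≡m y+1<n = refl

  residue-below : ∀ {r s} → s < r → r ≤ suc m → residue r s + suc s ≡ r
  residue-below {r} {s} s<r r≤m+1
    rewrite subtract-one r s | ℤP.⊖-≥ s<r
          | m<n⇒m%n≡m {n = suc (suc m)} (≤-<-trans (m∸n≤m r (suc s)) (s≤s r≤m+1))
    = m∸n+n≡m s<r

  residue-above : ∀ {r s} → r ≤ s → s ≤ m → residue r s + suc s ≡ r + suc (suc m)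
  residue-above {r} {s} r≤s s≤m
    rewrite subtract-one r s | ℤP.⊖-< (s≤s r≤s) | +-∸-assoc 1 r≤s
          | negative-residue (s ∸ r) (s≤s (s≤s (≤-trans (m∸n≤m s r) s≤m))) = begin
      (suc (suc m) ∸ suc (s ∸ r)) + suc s           ≡⟨ cong (_+_ (suc (suc m) ∸ suc (s ∸ r))) s+1≡ ⟩
      (suc (suc m) ∸ suc (s ∸ r)) + (suc (s ∸ r) + r) ≡⟨ +-assoc (suc (suc m) ∸ suc (s ∸ r)) _ r ⟨
      (suc (suc m) ∸ suc (s ∸ r)) + suc (s ∸ r) + r ≡⟨ cong (_+ r) (m∸n+n≡m s-r+1≤n) ⟩
      suc (suc m) + r                                ≡⟨ +-comm (suc (suc m)) r ⟩
      r + suc (suc m)                                ∎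
    where
    open ≡-Reasoning
    s+1≡ : suc s ≡ suc (s ∸ r) + r
    s+1≡ = cong suc (sym (m∸n+n≡m r≤s))
    s-r+1≤n : suc (s ∸ r) ≤ suc (suc m)
    s-r+1≤n = s≤s (≤-trans (m∸n≤m s r) (≤-trans s≤m (n≤1+n m)))

  residue-hits : ∀ {r s} → s ≤ m → r ≤ suc m → Hits r (residue r s) (suc s)
  residue-hits {r} {s} s≤m r≤m+1 with s <? r
  ... | yes s<r = inj₁ (residue-below s<r r≤m+1)
  ... | no  s≮r = inj₂ (residue-above (≮⇒≥ s≮r) s≤m)

  no-wrap : ∀ {x y t} → y < suc (suc m) → y + t ≡ x + t + suc (suc m) → ⊥
  no-wrap {x} {y} {t} y<n eq = <-irrefl refl (begin-strict
    y + t                   <⟨ +-monoˡ-< t y<n ⟩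
    suc (suc m) + t         ≡⟨ +-comm (suc (suc m)) t ⟩
    t + suc (suc m)         ≤⟨ +-monoˡ-≤ (suc (suc m)) (m≤n+m t x) ⟩
    x + t + suc (suc m)     ≡⟨ eq ⟨
    y + t                   ∎)
    where open ≤-Reasoning

  hits-unique : ∀ {r x y t} → x < suc (suc m) → y < suc (suc m) → Hits r x t → Hits r y t → x ≡ y
  hits-unique {t = t} _ _ (inj₁ x+t≡r) (inj₁ y+t≡r) = +-cancelʳ-≡ t _ _ (trans x+t≡r (sym y+t≡r))
  hits-unique {t = t} _ _ (inj₂ x+t≡r) (inj₂ y+t≡r) = +-cancelʳ-≡ t _ _ (trans x+t≡r (sym y+t≡r))
  hits-unique _   y<n (inj₁ x+t≡r) (inj₂ y+t≡r+n) =
    ⊥-elim (no-wrap y<n (trans y+t≡r+n (cong (_+ _) (sym x+t≡r))))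
  hits-unique x<n _   (inj₂ x+t≡r+n) (inj₁ y+t≡r) =
    ⊥-elim (no-wrap x<n (trans x+t≡r+n (cong (_+ _) (sym y+t≡r))))

  hits⇔absMod : ∀ {r s x} → s ≤ m → r ≤ suc m → x < suc (suc m) →
    Hits r x (suc s) ⇔ suc x ≡ absMod (suc (suc m)) (+ r - + s)
  hits⇔absMod {r} {s} s≤m r≤m+1 x<n = mk⇔
    (λ hits → cong suc (hits-unique x<n (n%ℕd<d ((+ r - + s) - + 1) (suc (suc m))) hits (residue-hits s≤m r≤m+1)))
    (λ x+1≡ → subst (λ y → Hits r y (suc s)) (sym (suc-injective x+1≡)) (residue-hits s≤m r≤m+1))

  -- The window as a Boolean test on 0 ≤ x < n: two intervals, below r and at the top.
  windowTest : ℕ → ℕ → ℕ → Bool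
  windowTest q r x = inInterval (r ∸ suc (q + 1)) r x ∨ inInterval (r + suc (suc m) ∸ suc (q + 1)) (suc (suc m)) x

  windowSet : ℕ → ℕ → Subset (suc (suc m))
  windowSet q r = tabulate (λ u → if windowTest q r (toℕ u) then inside else outside)

  window⇔windowTest : ∀ {q r x} → x < suc (suc m) → Window q r x ⇔ T (windowTest q r x)
  window⇔windowTest {q} {r} {x} x<n = mk⇔ to from
    where
    to : Window q r x → T (windowTest q r x)
    to (s , s≤q+1 , inj₁ x+s+1≡r) = Equivalence.from T-∨ (inj₁ (Equivalence.from (T-inInterval _ r x)
      (Equivalence.to (bounded-gap (q + 1) x r) (s , s≤q+1 , x+s+1≡r))))
    to (s , s≤q+1 , inj₂ x+s+1≡r+n) = Equivalence.from T-∨ (inj₂ (Equivalence.from (T-inInterval _ (suc (suc m)) x)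
      (proj₁ (Equivalence.to (bounded-gap (q + 1) x (r + suc (suc m))) (s , s≤q+1 , x+s+1≡r+n)) , x<n)))
    from : T (windowTest q r x) → Window q r x
    from t with Equivalence.to T-∨ t
    ... | inj₁ low with Equivalence.from (bounded-gap (q + 1) x r) (Equivalence.to (T-inInterval _ r x) low)
    ...   | s , s≤q+1 , x+s+1≡r = s , s≤q+1 , inj₁ x+s+1≡r
    from t | inj₂ top with Equivalence.to (T-inInterval _ (suc (suc m)) x) top
    ...   | lo , _ with Equivalence.from (bounded-gap (q + 1) x (r + suc (suc m))) (lo , <-≤-trans x<n (m≤n+m _ r))
    ...     | s , s≤q+1 , x+s+1≡r+n = s , s≤q+1 , inj₂ x+s+1≡r+n

  window-pieces-disjoint : ∀ {r d} → d ≤ suc (suc m) → ∀ x →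
    T (inInterval (r ∸ d) r x) → T (inInterval (r + suc (suc m) ∸ d) (suc (suc m)) x) → ⊥
  window-pieces-disjoint {r} {d} d≤n x low top = <-irrefl refl (begin-strict
    x                         <⟨ proj₂ (Equivalence.to (T-inInterval (r ∸ d) r x) low) ⟩
    r                         ≤⟨ m≤m+n r (suc (suc m) ∸ d) ⟩
    r + (suc (suc m) ∸ d)     ≡⟨ +-∸-assoc r d≤n ⟨
    r + suc (suc m) ∸ d       ≤⟨ proj₁ (Equivalence.to (T-inInterval _ (suc (suc m)) x) top) ⟩
    x                         ∎)
    where open ≤-Reasoning

  count-window : ∀ {q r} → q < m → r ≤ suc m → count (suc (suc m)) (windowTest q r) ≡ q + 2
  count-window {q} {r} q<m r≤m+1 = begin
    count n (windowTest q r)                      ≡⟨ count-∨ n (inInterval (r ∸ d) r) (inInterval (r + n ∸ d) n)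
                                                               (window-pieces-disjoint {r} {d} d≤n) ⟩
    count n (inInterval (r ∸ d) r) + count n (inInterval (r + n ∸ d) n)
                                                  ≡⟨ cong₂ _+_ (count-interval n (r ∸ d) r (m≤n⇒m≤1+n r≤m+1))
                                                               (count-interval n (r + n ∸ d) n ≤-refl) ⟩
    (r ∸ (r ∸ d)) + (n ∸ (r + n ∸ d))             ≡⟨ cyclic-interval-size r d n d≤n ⟩
    suc (q + 1)                                   ≡⟨ +-suc q 1 ⟨
    q + 2                                         ∎
    where
    open ≡-Reasoning
    n d : ℕ
    n = suc (suc m)
    d = suc (q + 1)
    d≤n : d ≤ n
    d≤n = s≤s (≤-trans (≤-reflexive (+-comm q 1)) (m≤n⇒m≤1+n q<m))

S-A₀-below : ∀ m′ m t (jₘ j : Fin (suc (suc m))) → toℕ jₘ ≡ m → toℕ j < m →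
  S (A₀ m′ (suc (suc m))) (suc t + (m ∸ toℕ j)) j ≡ S (A₀ m′ (suc (suc m))) (suc t) jₘ
S-A₀-below m′ m t jₘ j jₘ≡m j<m = S-A₀-ext m′ m (t + d) t j jₘ λ u →
  subst (λ ℓ → Walk (Arc m) ℓ u j ⇔ Walk (Arc m) (suc t) u jₘ) d+t+1≡t+d+1
        (walk-descend m d (suc t) jₘ≡m (m+[n∸m]≡n (<⇒≤ j<m)))
  where
  d : ℕ
  d = m ∸ toℕ j
  d+t+1≡t+d+1 : d + suc t ≡ suc (t + d)
  d+t+1≡t+d+1 = trans (+-suc d t) (cong suc (+-comm d t))

-- Part (ii) for j = n: S_{t+n-1}(𝔸₀, n) = S_t(𝔸₀, n-1).  In 0-based terms a
-- walk into m+1 arrives from 0, and a walk into 0 ends with the forced path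
-- m → m-1 → ⋯ → 0.
S-A₀-top : ∀ m′ m t (jₘ jₙ : Fin (suc (suc m))) → toℕ jₘ ≡ m → toℕ jₙ ≡ suc m →
  S (A₀ m′ (suc (suc m))) (suc t + suc (suc m) ∸ 1) jₙ ≡ S (A₀ m′ (suc (suc m))) (suc t) jₘ
S-A₀-top m′ m t jₘ jₙ jₘ≡m jₙ≡m+1 =
  trans (cong (λ ℓ → S (A₀ m′ (suc (suc m))) ℓ jₙ) length-eq)
        (S-A₀-ext m′ m (m + suc t) t jₙ jₘ λ u →
          walk-descend m m (suc t) jₘ≡m refl ⇔-∘ walk-into-top m (m + suc t) jₙ≡m+1)
  where
  length-eq : t + suc (suc m) ≡ suc (m + suc t)
  length-eq = trans (+-suc t (suc m)) (cong suc (trans (+-comm t (suc m)) (sym (+-suc m t))))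

S-A₀⇔window : ∀ m′ m k q r (jₘ : Fin (suc (suc m))) → toℕ jₘ ≡ m → suc k ≡ suc m * q + r →
  q < m → 1 ≤ r → r ≤ suc m → ∀ u → u ∈ S (A₀ m′ (suc (suc m))) (suc k) jₘ ⇔ Window m q r (toℕ u)
S-A₀⇔window m′ m k q r jₘ jₘ≡m k≡ q<m 1≤r r≤m+1 u = mk⇔
  (cycleCount⇒window m q<m r≤m+1 u≤m+1
    ∘ subst (λ ℓ → CycleCount m ℓ (toℕ u)) k≡
    ∘ walk⇒cycleCount m (suc k) jₘ≡m
    ∘ Equivalence.to (∈S-A₀⇔walk m′ m k u jₘ))
  (Equivalence.from (∈S-A₀⇔walk m′ m k u jₘ)
    ∘ cycleCount⇒walk m (suc k) jₘ≡m
    ∘ subst (λ ℓ → CycleCount m ℓ (toℕ u)) (sym k≡)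
    ∘ window⇒cycleCount m 1≤r u≤m+1)
  where
  u≤m+1 : toℕ u ≤ suc m
  u≤m+1 = s≤s⁻¹ (toℕ<n u)

-- The paper's description of the window: u + 1 = |r - s|_n for some s ≤ q + 1.
window⇔absMod : ∀ m q r x → q < m → r ≤ suc m → x < suc (suc m) →
  Window m q r x ⇔ ∃ (λ s → s ≤ q + 1 × suc x ≡ absMod (suc (suc m)) (+ r - + s))
window⇔absMod m q r x q<m r≤m+1 x<n = mk⇔
  (λ { (s , s≤q+1 , hits) → s , s≤q+1 , Equivalence.to (hits⇔absMod m (s≤m s≤q+1) r≤m+1 x<n) hits })
  (λ { (s , s≤q+1 , x+1≡) → s , s≤q+1 , Equivalence.from (hits⇔absMod m (s≤m s≤q+1) r≤m+1 x<n) x+1≡ })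
  where
  s≤m : ∀ {s} → s ≤ q + 1 → s ≤ m
  s≤m s≤q+1 = ≤-trans s≤q+1 (≤-trans (≤-reflexive (+-comm q 1)) q<m)

∣S-A₀∣ : ∀ m′ m k q r (jₘ : Fin (suc (suc m))) → toℕ jₘ ≡ m → suc k ≡ suc m * q + r →
  q < m → 1 ≤ r → r ≤ suc m → ∣ S (A₀ m′ (suc (suc m))) (suc k) jₘ ∣ ≡ q + 2
∣S-A₀∣ m′ m k q r jₘ jₘ≡m k≡ q<m 1≤r r≤m+1 = begin
  ∣ S (A₀ m′ (suc (suc m))) (suc k) jₘ ∣    ≡⟨ cong ∣_∣ S≡window ⟩
  ∣ windowSet m q r ∣                        ≡⟨ ∣tabulate∣≡count (suc (suc m)) (windowTest m q r) ⟩
  count (suc (suc m)) (windowTest m q r)     ≡⟨ count-window m q<m r≤m+1 ⟩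
  q + 2                                      ∎
  where
  open ≡-Reasoning
  S≡window : S (A₀ m′ (suc (suc m))) (suc k) jₘ ≡ windowSet m q r
  S≡window = subset-ext λ u →
    ⇔-sym (∈-decided⇔ (windowTest m q r ∘ toℕ) u)
      ⇔-∘ (window⇔windowTest m (toℕ<n u) ⇔-∘ S-A₀⇔window m′ m k q r jₘ jₘ≡m k≡ q<m 1≤r r≤m+1 u)

-- The hypothesis k ≤ n² - 3n + 2 = m(m+1) forces q < m.
quotient<m : ∀ m {q r} → 1 ≤ r →
  suc m * q + r ≤ suc (suc m) * suc (suc m) + 2 ∸ 3 * suc (suc m) → q < m
quotient<m m {q} {r} 1≤r k≤bound = ≰⇒> λ m≤q → <-irrefl refl (begin-strict
  m * suc m                                             ≡⟨ *-comm m (suc m) ⟩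
  suc m * m                                             ≤⟨ *-monoʳ-≤ (suc m) m≤q ⟩
  suc m * q                                             <⟨ m<m+n _ 1≤r ⟩
  suc m * q + r                                         ≤⟨ k≤bound ⟩
  suc (suc m) * suc (suc m) + 2 ∸ 3 * suc (suc m)       ≡⟨ cong (_∸ 3 * suc (suc m)) (expand m) ⟩
  m * suc m + 3 * suc (suc m) ∸ 3 * suc (suc m)         ≡⟨ m+n∸n≡m (m * suc m) (3 * suc (suc m)) ⟩
  m * suc m                                             ∎)
  where
  open ≤-Reasoning
  expand : ∀ m → suc (suc m) * suc (suc m) + 2 ≡ m * suc m + 3 * suc (suc m)
  expand = solve-∀

part-i : ∀ m′ m (jₘ : Fin (suc (suc m))) → toℕ jₘ ≡ m →
  (k q r : ℕ) → 1 ≤ k → k ≤ suc (suc m) * suc (suc m) + 2 ∸ 3 * suc (suc m) →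
  k ≡ suc m * q + r → 1 ≤ r → r ≤ suc m →
  ((u : Fin (suc (suc m))) → (u ∈ S (A₀ m′ (suc (suc m))) k jₘ ⇔
      ∃ (λ s → s ≤ q + 1 × suc (toℕ u) ≡ absMod (suc (suc m)) (+ r - + s))))
  × ∣ S (A₀ m′ (suc (suc m))) k jₘ ∣ ≡ q + 2
part-i m′ m jₘ jₘ≡m (suc k) q r (s≤s z≤n) k≤bound k≡ 1≤r r≤m+1 =
  (λ u → window⇔absMod m q r (toℕ u) q<m r≤m+1 (toℕ<n u)
           ⇔-∘ S-A₀⇔window m′ m k q r jₘ jₘ≡m k≡ q<m 1≤r r≤m+1 u) ,
  ∣S-A₀∣ m′ m k q r jₘ jₘ≡m k≡ q<m 1≤r r≤m+1
  where
  q<m : q < m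
  q<m = quotient<m m 1≤r (subst (_≤ suc (suc m) * suc (suc m) + 2 ∸ 3 * suc (suc m)) k≡ k≤bound)

part-ii : ∀ m′ m (jₘ : Fin (suc (suc m))) → toℕ jₘ ≡ m → (t : ℕ) → 1 ≤ t →
  ((j : Fin (suc (suc m))) → 1 ≤ suc (toℕ j) → suc (toℕ j) ≤ m →
     S (A₀ m′ (suc (suc m))) (t + (suc m ∸ suc (toℕ j))) j ≡ S (A₀ m′ (suc (suc m))) t jₘ)
  × ((jₙ : Fin (suc (suc m))) → suc (toℕ jₙ) ≡ suc (suc m) →
     S (A₀ m′ (suc (suc m))) (t + suc (suc m) ∸ 1) jₙ ≡ S (A₀ m′ (suc (suc m))) t jₘ)
part-ii m′ m jₘ jₘ≡m (suc t) (s≤s z≤n) =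
  (λ j _ j<m → S-A₀-below m′ m t jₘ j jₘ≡m j<m) ,
  (λ jₙ jₙ≡n → S-A₀-top m′ m t jₘ jₙ jₘ≡m (suc-injective jₙ≡n))

proposition2p14 : (m' n : ℕ) → 2 ≤ n →
    ((jₙ₋₁ : Fin n) → suc (toℕ jₙ₋₁) ≡ n ∸ 1 →
      ((k q r : ℕ) → 1 ≤ k → k ≤ n * n + 2 ∸ 3 * n → k ≡ (n ∸ 1) * q + r →
        1 ≤ r → r ≤ n ∸ 1 →
        ((u : Fin n) → (u ∈ S (A₀ m' n) k jₙ₋₁ ⇔
            ∃ (λ s → s ≤ q + 1 × suc (toℕ u) ≡ absMod n (+ r - + s))))
        × ∣ S (A₀ m' n) k jₙ₋₁ ∣ ≡ q + 2)
      × ((t : ℕ) → 1 ≤ t →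
          ((j : Fin n) → 1 ≤ suc (toℕ j) → suc (toℕ j) ≤ n ∸ 2 →
             S (A₀ m' n) (t + (n ∸ 1 ∸ suc (toℕ j))) j ≡ S (A₀ m' n) t jₙ₋₁)
          × ((jₙ : Fin n) → suc (toℕ jₙ) ≡ n →
             S (A₀ m' n) (t + n ∸ 1) jₙ ≡ S (A₀ m' n) t jₙ₋₁)))
proposition2p14 m′ (suc (suc m)) (s≤s (s≤s z≤n)) jₘ jₘ+1≡n-1 =
  part-i m′ m jₘ jₘ≡m , part-ii m′ m jₘ jₘ≡m
  where
  jₘ≡m : toℕ jₘ ≡ m
  jₘ≡m = suc-injective jₘ+1≡n-1
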